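{- Let $s\ge t\ge0$ be integers, $\mathbf a=(a_1,\ldots,a_s)\in\mathbb{N}_{(p)}^s$, $\mathbf b=(b_1,\ldots,b_t)\in\mathbb{N}_{(p)}^t$ and $d\in\mathbb{Z}_{\ge1}$. There exists $C>0$ such that for all $\gamma\in\frac1d\mathbb{Z}$ and all $k_1,\ldots,k_s,\ell_1,\ldots,\ell_t\in\mathbb{Z}_{\ge1}$ with $k_1,\ldots,k_s\ge C$, the following are equivalent: (1) $\dfrac{a_1}{p^{k_1}}+\dfrac{a_2}{p^{k_1+k_2}}+\cdots+\dfrac{a_s}{p^{k_1+\cdots+k_s}}=\gamma+\dfrac{b_1}{p^{\ell_1}}+\dfrac{b_2}{p^{\ell_1+\ell_2}}+\cdots+\dfrac{b_t}{p^{\ell_1+\cdots+\ell_t}}$; (2) $\gamma=0$, $s=t$, and $a_i=b_i$ and $k_i=\ell_i$ for all $i\in\{1,\ldots,t\}$.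
   Context: $p\ge2$ is a fixed integer, and $\mathbb{N}_{(p)}$ denotes the set of positive rational numbers whose denominator (in lowest terms) is coprime to $p$ and whose numerator is not divisible by $p$. -}

module Defs where

open import Data.Nat as ℕ using (ℕ; NonZero; _+_; _^_)
open import Data.Nat.Divisibility using (_∣_)
open import Data.Nat.Properties using (m^n≢0)
open import Data.Nat.Coprimality using (Coprime)
open import Data.Integer as ℤ using (ℤ; +_)
open import Data.Rational as ℚ using (ℚ; 0ℚ; _/_; _<_; ↥_; ↧ₙ_)
open import Data.Vec using (Vec; []; _∷_)
open import Data.Product using (_×_)
open import Relation.Nullary using (¬_)

-- q ∈ ℕ_(p): positive rational, numerator (in lowest terms) not divisible by p,
-- denominator (in lowest terms) coprime to p.  (ℚ in stdlib is always normalised.)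
InNp : ℕ → ℚ → Set
InNp p q = (0ℚ < q) × (¬ (p ∣ ℤ.∣ ↥ q ∣)) × Coprime (↧ₙ q) p

invPow : (p : ℕ) .{{_ : NonZero p}} → ℕ → ℚ
invPow p m = _/_ (+ 1) (p ^ m) {{m^n≢0 p m}}

pSumFrom : (p : ℕ) .{{_ : NonZero p}} → ℕ → {n : ℕ} → Vec ℚ n → Vec ℕ n → ℚ
pSumFrom p off [] [] = 0ℚ
pSumFrom p off (a ∷ as) (k ∷ ks) = a ℚ.* invPow p (off + k) ℚ.+ pSumFrom p (off + k) as ks

pSum : (p : ℕ) .{{_ : NonZero p}} → {n : ℕ} → Vec ℚ n → Vec ℕ n → ℚ
pSum p = pSumFrom p 0

-- Multiply the identity by W·p^E, where W is prime to p and divisible by the denominators of all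
-- aᵢ, bⱼ and by the p-free part of d, and p^E clears all powers of p.  Each side becomes an integer
-- Σ cᵢ·p^(E−Kᵢ) with Kᵢ = k₁ + ⋯ + kᵢ and digits cᵢ = aᵢW prime to p and below p^g, while the
-- γ-term is divisible by p^(E−D).  Compare the sides starting from the least significant left-hand
-- term A·p^(E−K): modulo p^(E−K+g) it can only be balanced by the right-hand terms of exponent in
-- (K−g, K] plus a carry from the terms already compared, and since consecutive left exponents are at
-- least 2g + D + (carry bound) apart the carry stays small, so at least one such right-hand term
-- exists.  Hence s ≤ t; when s = t there is exactly one, and it must be A·p^(E−K) itself.
-- Induction identifies all terms, and then γ = 0.

module Submission where

open import Data.Nat as ℕ using (ℕ; zero; suc; NonZero; _+_; _*_; _∸_; _^_; _≤_; _<_; z≤n; s≤s; _⊔_)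
open import Data.Nat.Properties
open import Data.Nat.Divisibility as ℕD using (_∣_; divides)
open import Data.Nat.Coprimality as Coprimality using (Coprime; coprime?)
open import Data.Nat.GCD using (gcd; gcd[m,n]∣m; gcd[m,n]∣n; gcd[m,n]≢0)
open import Data.Nat.Induction using (<-rec)
open import Data.Nat.DivMod using (m*[n/m]≡n)
import Data.Nat.Tactic.RingSolver as ℕSolver
open import Data.Integer as ℤ using (ℤ; +_; -[1+_]; ∣_∣; 0ℤ)
import Data.Integer.Properties as ℤP
open import Data.Integer.Divisibility.Signed as ℤD using () renaming (_∣_ to _∣ℤ_)
open import Data.Integer.Tactic.RingSolver using (solve-∀)
open import Data.Rational as ℚ using (ℚ; mkℚ; 0ℚ; ↥_; ↧ₙ_; _/_)
open import Data.Rational.Literals using (fromℤ)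
open import Data.Rational.Solver using (module +-*-Solver)
import Data.Rational.Properties as ℚP
import Algebra.Properties.Group ℚP.+-0-group as GroupP
open import Data.Rational.Unnormalised using (mkℚᵘ; *≡*)
import Data.Rational.Unnormalised.Properties as ℚᵘP
open import Data.List using (List; []; _∷_; length; _++_; _ʳ++_; reverse)
import Data.List.Properties as ListP
import Data.Vec.Properties as VecP
open import Data.List.Relation.Unary.All as ListAll using ([]; _∷_)
open import Data.List.Relation.Unary.All.Properties using (++⁻ˡ; ++⁻ʳ)
open import Data.Vec using (Vec; []; _∷_; toList; sum; map)
open import Data.Vec.Relation.Unary.All as AllV using (All; []; _∷_)
open import Data.Product using (Σ; _×_; _,_; proj₁; proj₂)
open import Data.Sum using (inj₁; inj₂)
open import Data.Empty using (⊥-elim)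
open import Function using (_∘_)
open import Data.Unit using (⊤; tt)
open import Function.Bundles using (_⇔_; mk⇔)
open import Relation.Binary.PropositionalEquality
open import Relation.Binary.Definitions using (tri<; tri≈; tri>)
open import Relation.Nullary using (¬_; yes; no)

open import Defs

fromℤ-+ : ∀ i j → fromℤ (i ℤ.+ j) ≡ fromℤ i ℚ.+ fromℤ j
fromℤ-+ i j = ℚP.toℚᵘ-injective (ℚᵘP.≃-sym (ℚᵘP.≃-trans (ℚP.toℚᵘ-homo-+ (fromℤ i) (fromℤ j))
  (*≡* (cong (ℤ._* + 1) (cong₂ ℤ._+_ (ℤP.*-identityʳ i) (ℤP.*-identityʳ j))))))

fromℤ-* : ∀ i j → fromℤ (i ℤ.* j) ≡ fromℤ i ℚ.* fromℤ j
fromℤ-* i j = ℚP.toℚᵘ-injective (ℚᵘP.≃-sym (ℚP.toℚᵘ-homo-* (fromℤ i) (fromℤ j)))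

fromℤ-injective : ∀ {i j} → fromℤ i ≡ fromℤ j → i ≡ j
fromℤ-injective = cong ℚ.↥_

/-*-cancel : ∀ i d .{{_ : NonZero d}} → (i / d) ℚ.* fromℤ (+ d) ≡ fromℤ i
/-*-cancel i (suc d-1) = ℚP.toℚᵘ-injective (ℚᵘP.≃-trans (ℚP.toℚᵘ-homo-* (i / suc d-1) (fromℤ (+ suc d-1)))
  (ℚᵘP.≃-trans (ℚᵘP.*-congʳ (ℚP.toℚᵘ-fromℚᵘ (mkℚᵘ i d-1))) (*≡* cross)))
  where
  cross : (i ℤ.* + suc d-1) ℤ.* + 1 ≡ i ℤ.* + suc (d-1 ℕ.* 1)
  cross = trans (ℤP.*-identityʳ (i ℤ.* + suc d-1)) (cong (λ m → i ℤ.* + suc m) (sym (*-identityʳ d-1)))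

*-cancelʳ-fromℕ : ∀ {x y} n .{{_ : NonZero n}} → x ℚ.* fromℤ (+ n) ≡ y ℚ.* fromℤ (+ n) → x ≡ y
*-cancelʳ-fromℕ (suc n) eq =
  ℚP.≤-antisym (ℚP.*-cancelʳ-≤-pos r (ℚP.≤-reflexive eq)) (ℚP.*-cancelʳ-≤-pos r (ℚP.≤-reflexive (sym eq)))
  where r = fromℤ (+ suc n)

+∣↥∣≡↥ : ∀ x → 0ℚ ℚ.< x → + ∣ ↥ x ∣ ≡ ↥ x
+∣↥∣≡↥ (mkℚ (+ n) _ _) _ = refl
+∣↥∣≡↥ x@(mkℚ -[1+ n ] _ _) 0<x with ℚ.positive {x} 0<x
... | ()

∣ℤ-small⇒≡0 : ∀ {m} {i : ℤ} → + m ∣ℤ i → ∣ i ∣ < m → i ≡ 0ℤ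
∣ℤ-small⇒≡0 {m} {i} m∣i ∣i∣<m with ∣ i ∣ ℕ.≟ 0
... | yes ∣i∣≡0 = ℤP.∣i∣≡0⇒i≡0 ∣i∣≡0
... | no ∣i∣≢0 = ⊥-elim (<⇒≱ ∣i∣<m (ℕD.∣⇒≤ {{ℕ.≢-nonZero ∣i∣≢0}} (ℤD.∣⇒∣ᵤ m∣i)))

∣ℤ-small-diff⇒≡ : ∀ {m a b} → + m ∣ℤ + a ℤ.- + b → a < m → b < m → a ≡ b
∣ℤ-small-diff⇒≡ {m} {a} {b} m∣a-b a<m b<m =
  ℤP.+-injective (ℤP.i-j≡0⇒i≡j (+ a) (+ b) (∣ℤ-small⇒≡0 m∣a-b ∣a-b∣<m))
  where
  ∣a-b∣<m : ∣ + a ℤ.- + b ∣ < m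
  ∣a-b∣<m = ≤-<-trans
    (subst (λ z → ∣ z ∣ ≤ a ⊔ b) (sym (ℤP.[+m]-[+n]≡m⊖n a b)) (ℤP.∣m⊝n∣≤m⊔n a b))
    (⊔-lub a<m b<m)

∣ℤ-diff∣ʳ⇒∣ˡ : ∀ {d a b} → + d ∣ℤ + a ℤ.- + b → d ∣ b → d ∣ a
∣ℤ-diff∣ʳ⇒∣ˡ {d} {a} {b} d∣a-b d∣b =
  ℤD.∣⇒∣ᵤ (subst (+ d ∣ℤ_) (a-b+b≡a (+ a) (+ b)) (ℤD.∣m∣n⇒∣m+n d∣a-b (ℤD.∣ᵤ⇒∣ d∣b)))
  where
  a-b+b≡a : ∀ x y → (x ℤ.- y) ℤ.+ y ≡ x
  a-b+b≡a = solve-∀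

∣ℤ-diff∣ˡ⇒∣ʳ : ∀ {d a b} → + d ∣ℤ + a ℤ.- + b → d ∣ a → d ∣ b
∣ℤ-diff∣ˡ⇒∣ʳ {d} {a} {b} d∣a-b d∣a =
  ℤD.∣⇒∣ᵤ (subst (+ d ∣ℤ_) (a-[a-b]≡b (+ a) (+ b))
    (ℤD.∣m∣n⇒∣m-n {m = + a} (ℤD.∣ᵤ⇒∣ d∣a) d∣a-b))
  where
  a-[a-b]≡b : ∀ x y → x ℤ.- (x ℤ.- y) ≡ y
  a-[a-b]≡b = solve-∀

+[m*n]+i≢0 : ∀ {m n i} → 1 ≤ m → ∣ i ∣ < n → + (m * n) ℤ.+ i ≢ 0ℤ
+[m*n]+i≢0 {m} {n} {i} 1≤m ∣i∣<n sum≡0 = <⇒≱ ∣i∣<n (subst (n ≤_) (sym ∣i∣≡mn) n≤mn)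
  where
  ∣i∣≡mn : ∣ i ∣ ≡ m * n
  ∣i∣≡mn = begin
    ∣ i ∣                                ≡⟨ cong ∣_∣ (cancel (+ (m * n)) i) ⟩
    ∣ (+ (m * n) ℤ.+ i) ℤ.- + (m * n) ∣   ≡⟨ cong (λ y → ∣ y ℤ.- + (m * n) ∣) sum≡0 ⟩
    ∣ 0ℤ ℤ.- + (m * n) ∣                 ≡⟨ cong ∣_∣ (ℤP.+-identityˡ (ℤ.- + (m * n))) ⟩
    ∣ ℤ.- + (m * n) ∣                    ≡⟨ ℤP.∣-i∣≡∣i∣ (+ (m * n)) ⟩
    m * n                                ∎
    where
    open ≡-Reasoning
    cancel : ∀ a i → i ≡ (a ℤ.+ i) ℤ.- a
    cancel = solve-∀
  n≤mn : n ≤ m * n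
  n≤mn = subst (_≤ m * n) (+-identityʳ n) (*-monoˡ-≤ n 1≤m)

pos-*-distribʳ-‿- : ∀ a b c → + (a * c) ℤ.- + (b * c) ≡ (+ a ℤ.- + b) ℤ.* + c
pos-*-distribʳ-‿- a b c = begin
  + (a * c) ℤ.- + (b * c)           ≡⟨ cong₂ ℤ._-_ (ℤP.pos-* a c) (ℤP.pos-* b c) ⟩
  + a ℤ.* + c ℤ.- + b ℤ.* + c       ≡⟨ distrib (+ a) (+ b) (+ c) ⟩
  (+ a ℤ.- + b) ℤ.* + c             ∎
  where
  open ≡-Reasoning
  distrib : ∀ x y z → x ℤ.* z ℤ.- y ℤ.* z ≡ (x ℤ.- y) ℤ.* z
  distrib = solve-∀

coprime-* : ∀ {m n p} → Coprime m p → Coprime n p → Coprime (m * n) p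
coprime-* {m} {n} {p} m⊥p n⊥p {x} (x∣mn , x∣p) = n⊥p (Coprimality.coprime-divisor x⊥m x∣mn , x∣p)
  where
  x⊥m : Coprime x m
  x⊥m (y∣x , y∣m) = m⊥p (y∣m , ℕD.∣-trans y∣x x∣p)

coprime-∣ : ∀ {m n p} → Coprime m p → n ∣ m → Coprime n p
coprime-∣ m⊥p n∣m (x∣n , x∣p) = m⊥p (ℕD.∣-trans x∣n n∣m , x∣p)

record CoprimeMultiple (p d : ℕ) : Set where
  field
    exponent : ℕ
    cofactor : ℕ
    {{cofactor-nonZero}} : NonZero cofactor
    cofactor-coprime : Coprime cofactor p
    divides-multiple : d ∣ cofactor * p ^ exponent

coprimeMultiple : ∀ p d .{{_ : NonZero d}} → CoprimeMultiple p d
coprimeMultiple p = <-rec (λ d → .{{NonZero d}} → CoprimeMultiple p d) step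
  where
  step : ∀ d → (∀ {d'} → d' < d → .{{NonZero d'}} → CoprimeMultiple p d') → .{{NonZero d}} → CoprimeMultiple p d
  -- Peel off gcd d p, which divides p, and recurse on the cofactor.
  step d rec with coprime? d p
  ... | yes d⊥p = record
    { exponent = 0 ; cofactor = d ; cofactor-nonZero = ℕ.≢-nonZero (ℕ.≢-nonZero⁻¹ d)
    ; cofactor-coprime = d⊥p ; divides-multiple = ℕD.∣-reflexive (sym (*-identityʳ d)) }
  ... | no ¬d⊥p = record
    { exponent = suc exponent ; cofactor = cofactor ; cofactor-nonZero = cofactor-nonZero
    ; cofactor-coprime = cofactor-coprime
    ; divides-multiple = subst₂ _∣_ (sym (ℕD.m∣n⇒n≡m*quotient g∣d)) (rearrange p cofactor (p ^ exponent))
        (ℕD.*-pres-∣ (gcd[m,n]∣n d p) divides-multiple) }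
    where
    g = gcd d p
    g∣d = gcd[m,n]∣m d p
    instance
      g-nonTrivial : ℕ.NonTrivial g
      g-nonTrivial = ℕ.n>1⇒nonTrivial (gcd≢0,1 g refl)
        where
        gcd≢0,1 : ∀ x → x ≡ gcd d p → 1 < x
        gcd≢0,1 0 eq = ⊥-elim (gcd[m,n]≢0 d p (inj₁ (ℕ.≢-nonZero⁻¹ d)) (sym eq))
        gcd≢0,1 1 eq = ⊥-elim (¬d⊥p (Coprimality.gcd≡1⇒coprime (sym eq)))
        gcd≢0,1 (suc (suc x)) _ = s≤s (s≤s z≤n)
    open CoprimeMultiple (rec (ℕD.quotient-< g∣d) {{ℕD.quotient≢0 g∣d}})
    rearrange : ∀ x y z → x * (y * z) ≡ y * (x * z)
    rearrange = ℕSolver.solve-∀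

denominatorProduct : ∀ {n} → Vec ℚ n → ℕ
denominatorProduct [] = 1
denominatorProduct (x ∷ xs) = ↧ₙ x * denominatorProduct xs

denominatorProduct-nonZero : ∀ {n} (xs : Vec ℚ n) → NonZero (denominatorProduct xs)
denominatorProduct-nonZero [] = _
denominatorProduct-nonZero (x@(mkℚ _ _ _) ∷ xs) =
  m*n≢0 (↧ₙ x) (denominatorProduct xs) {{_}} {{denominatorProduct-nonZero xs}}

↧∣denominatorProduct : ∀ {n} (xs : Vec ℚ n) → All (λ x → ↧ₙ x ∣ denominatorProduct xs) xs
↧∣denominatorProduct [] = []
↧∣denominatorProduct (x ∷ xs) =
  ℕD.m∣m*n (denominatorProduct xs) ∷
  AllV.map (λ ↧∣ → ℕD.∣-trans ↧∣ (ℕD.n∣m*n (↧ₙ x))) (↧∣denominatorProduct xs)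

denominatorProduct-coprime : ∀ {p n} (xs : Vec ℚ n) → All (InNp p) xs → Coprime (denominatorProduct xs) p
denominatorProduct-coprime {p} [] [] = Coprimality.1-coprimeTo p
denominatorProduct-coprime (x ∷ xs) ((_ , _ , ↧x⊥p) ∷ xs∈) = coprime-* ↧x⊥p (denominatorProduct-coprime xs xs∈)

≤-sum-map : ∀ {A : Set} (f : A → ℕ) {n} (xs : Vec A n) → All (λ x → f x ≤ sum (map f xs)) xs
≤-sum-map f [] = []
≤-sum-map f (x ∷ xs) = m≤m+n (f x) _ ∷ AllV.map (λ le → ≤-trans le (m≤n+m _ (f x))) (≤-sum-map f xs)

module Scaling (W : ℕ) .{{_ : NonZero W}} where

  Admissible : ℚ → Set
  Admissible x = 0ℚ ℚ.< x × ↧ₙ x ∣ W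

  scale : ℚ → ℕ
  scale x = ∣ ↥ x ∣ * (W ℕ./ ↧ₙ x)

  scale-correct : ∀ {x} → Admissible x → x ℚ.* fromℤ (+ W) ≡ fromℤ (+ scale x)
  scale-correct {x} (0<x , ↧x∣W) = begin
    x ℚ.* fromℤ (+ W)
      ≡⟨ cong (λ z → x ℚ.* fromℤ (+ z)) (sym (m*[n/m]≡n ↧x∣W)) ⟩
    x ℚ.* fromℤ (+ (v * w))
      ≡⟨ cong (λ z → x ℚ.* z) (trans (cong fromℤ (ℤP.pos-* v w)) (fromℤ-* (+ v) (+ w))) ⟩
    x ℚ.* (fromℤ (+ v) ℚ.* fromℤ (+ w))
      ≡⟨ ℚP.*-assoc x (fromℤ (+ v)) (fromℤ (+ w)) ⟨
    (x ℚ.* fromℤ (+ v)) ℚ.* fromℤ (+ w)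
      ≡⟨ cong (λ z → (z ℚ.* fromℤ (+ v)) ℚ.* fromℤ (+ w)) (ℚP.↥p/↧p≡p x) ⟨
    ((↥ x ℚ./ v) ℚ.* fromℤ (+ v)) ℚ.* fromℤ (+ w)
      ≡⟨ cong (ℚ._* fromℤ (+ w)) (/-*-cancel (↥ x) v) ⟩
    fromℤ (↥ x) ℚ.* fromℤ (+ w)
      ≡⟨ fromℤ-* (↥ x) (+ w) ⟨
    fromℤ (↥ x ℤ.* + w)
      ≡⟨ cong (λ z → fromℤ (z ℤ.* + w)) (+∣↥∣≡↥ x 0<x) ⟨
    fromℤ (+ ∣ ↥ x ∣ ℤ.* + w)
      ≡⟨ cong fromℤ (ℤP.pos-* ∣ ↥ x ∣ w) ⟨
    fromℤ (+ scale x) ∎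
    where
    open ≡-Reasoning
    v = ↧ₙ x
    w = W ℕ./ v

  p∤scale : ∀ {p x} → Coprime W p → InNp p x → ↧ₙ x ∣ W → ¬ p ∣ scale x
  p∤scale {p} {x} W⊥p (_ , p∤↥x , _) ↧x∣W p∣scale =
    p∤↥x (Coprimality.coprime-divisor p⊥w (subst (p ∣_) (*-comm ∣ ↥ x ∣ (W ℕ./ ↧ₙ x)) p∣scale))
    where
    p⊥w : Coprime p (W ℕ./ ↧ₙ x)
    p⊥w = Coprimality.sym (coprime-∣ W⊥p (ℕD.m/n∣m ↧x∣W))

  scale-injective : ∀ {x y} → Admissible x → Admissible y → scale x ≡ scale y → x ≡ y
  scale-injective {x} {y} x-admissible y-admissible eq = *-cancelʳ-fromℕ W (begin
    x ℚ.* fromℤ (+ W)    ≡⟨ scale-correct x-admissible ⟩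
    fromℤ (+ scale x)    ≡⟨ cong (λ z → fromℤ (+ z)) eq ⟩
    fromℤ (+ scale y)    ≡⟨ scale-correct y-admissible ⟨
    y ℚ.* fromℤ (+ W)    ∎)
    where open ≡-Reasoning

∸-split : ∀ {a b c} → a ≤ b → b ≤ c → c ∸ a ≡ (b ∸ a) + (c ∸ b)
∸-split {a} {b} {c} a≤b b≤c = begin
  c ∸ a               ≡⟨ cong (_∸ a) (m∸n+n≡m b≤c) ⟨
  (c ∸ b + b) ∸ a     ≡⟨ +-∸-assoc (c ∸ b) a≤b ⟩
  (c ∸ b) + (b ∸ a)   ≡⟨ +-comm (c ∸ b) (b ∸ a) ⟩
  (b ∸ a) + (c ∸ b)   ∎
  where open ≡-Reasoning

module Powers (p : ℕ) .{{_ : NonZero p}} where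

  instance
    p^n-nonZero : ∀ {n} → NonZero (p ^ n)
    p^n-nonZero {n} = m^n≢0 p n

  p^-split : ∀ {a b c} → a ≤ b → b ≤ c → p ^ (c ∸ a) ≡ p ^ (b ∸ a) * p ^ (c ∸ b)
  p^-split {a} {b} {c} a≤b b≤c = trans (cong (p ^_) (∸-split a≤b b≤c)) (^-distribˡ-+-* p (b ∸ a) (c ∸ b))

  p^-mono-∣ : ∀ {a b} → a ≤ b → p ^ a ∣ p ^ b
  p^-mono-∣ {a} {b} a≤b =
    divides (p ^ (b ∸ a)) (trans (cong (p ^_) (sym (m∸n+n≡m a≤b))) (^-distribˡ-+-* p (b ∸ a) a))

  p∣p^ : ∀ {n} → 1 ≤ n → p ∣ p ^ n
  p∣p^ {suc n} _ = divides (p ^ n) (*-comm p (p ^ n))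

  n<p^n : 2 ≤ p → ∀ n → n < p ^ n
  n<p^n p≥2 zero = s≤s z≤n
  n<p^n p≥2 (suc n) = begin-strict
    suc n           <⟨ s≤s (n<p^n p≥2 n) ⟩
    suc (p ^ n)     ≤⟨ +-monoˡ-≤ (p ^ n) (m^n>0 p n) ⟩
    p ^ n + p ^ n   ≡⟨ cong (λ z → p ^ n + z) (+-identityʳ (p ^ n)) ⟨
    2 * p ^ n       ≤⟨ *-monoˡ-≤ (p ^ n) p≥2 ⟩
    p * p ^ n       ∎
    where open ≤-Reasoning

  *p^-split : ∀ c {a b E} → a ≤ b → b ≤ E → c * p ^ (E ∸ a) ≡ (c * p ^ (b ∸ a)) * p ^ (E ∸ b)
  *p^-split c a≤b b≤E = trans (cong (c *_) (p^-split a≤b b≤E)) (sym (*-assoc c _ _))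

  +p^-∣ℤ-cancelʳ : ∀ a b {i : ℤ} → + (p ^ a * p ^ b) ∣ℤ i ℤ.* + p ^ b → + p ^ a ∣ℤ i
  +p^-∣ℤ-cancelʳ a b {i} h =
    ℤD.*-cancelʳ-∣ (+ p ^ b) {{m^n≢0 p b}} (subst (_∣ℤ i ℤ.* + p ^ b) (ℤP.pos-* (p ^ a) (p ^ b)) h)

Term : Set
Term = ℕ × ℕ

All-ʳ++ : ∀ {A : Set} {P : A → Set} {xs ys} → ListAll.All P xs → ListAll.All P ys → ListAll.All P (xs ʳ++ ys)
All-ʳ++ [] pys = pys
All-ʳ++ (px ∷ pxs) pys = All-ʳ++ pxs (px ∷ pys)

module _ {A : Set} (f : A → ℕ) where

  terms : ∀ {n} → ℕ → Vec A n → Vec ℕ n → List Term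
  terms off [] [] = []
  terms off (x ∷ xs) (k ∷ ks) = (f x , off + k) ∷ terms (off + k) xs ks

  length-terms : ∀ {n} off (xs : Vec A n) ks → length (terms off xs ks) ≡ n
  length-terms off [] [] = refl
  length-terms off (x ∷ xs) (k ∷ ks) = cong suc (length-terms (off + k) xs ks)

  All-terms : ∀ {n} {P : ℕ → Set} off (xs : Vec A n) ks →
    All (λ x → P (f x)) xs → ListAll.All (λ t → P (proj₁ t)) (terms off xs ks)
  All-terms off [] [] [] = []
  All-terms off (x ∷ xs) (k ∷ ks) (px ∷ pxs) = px ∷ All-terms (off + k) xs ks pxs

  terms-injective : ∀ {m n} {R : A → Set} → (∀ {x y} → R x → R y → f x ≡ f y → x ≡ y) →
    ∀ off (xs : Vec A m) ks (ys : Vec A n) ls → All R xs → All R ys →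
    terms off xs ks ≡ terms off ys ls → toList xs ≡ toList ys × toList ks ≡ toList ls
  terms-injective f-inj off [] [] [] [] _ _ _ = refl , refl
  terms-injective f-inj off [] [] (y ∷ ys) (l ∷ ls) _ _ ()
  terms-injective f-inj off (x ∷ xs) (k ∷ ks) [] [] _ _ ()
  terms-injective f-inj off (x ∷ xs) (k ∷ ks) (y ∷ ys) (l ∷ ls) (rx ∷ rxs) (ry ∷ rys) eq
    with ListP.∷-injective eq
  ... | head≡ , tail≡ with +-cancelˡ-≡ off k l (cong proj₂ head≡)
  ... | refl with terms-injective f-inj (off + k) xs ks ys ls rxs rys tail≡
  ... | xs≡ys , ks≡ls = cong₂ _∷_ (f-inj rx ry (cong proj₁ head≡)) xs≡ys , cong (k ∷_) ks≡ls

module Expansion (p : ℕ) .{{_ : NonZero p}} (E : ℕ) where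

  open Powers p

  -- (c , K) stands for c·p^(E ∸ K), that is c/p^K scaled by p^E.
  value : List Term → ℕ
  value [] = 0
  value ((c , K) ∷ ts) = c * p ^ (E ∸ K) + value ts

  value-++ : ∀ ts us → value (ts ++ us) ≡ value ts + value us
  value-++ [] us = refl
  value-++ ((c , K) ∷ ts) us =
    trans (cong (λ v → c * p ^ (E ∸ K) + v) (value-++ ts us)) (sym (+-assoc (c * p ^ (E ∸ K)) (value ts) (value us)))

  p^-∣value : ∀ {θ} ts → ListAll.All (λ t → proj₂ t ≤ θ) ts → p ^ (E ∸ θ) ∣ value ts
  p^-∣value [] [] = ℕD._∣0 _
  p^-∣value ((c , K) ∷ ts) (K≤θ ∷ ≤θ) =
    ℕD.∣m∣n⇒∣m+n (ℕD.∣n⇒∣m*n c (p^-mono-∣ (∸-monoʳ-≤ E K≤θ))) (p^-∣value ts ≤θ)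

  value-ʳ++ : ∀ ts us → value (ts ʳ++ us) ≡ value ts + value us
  value-ʳ++ [] us = refl
  value-ʳ++ ((c , K) ∷ ts) us = begin
    value (ts ʳ++ (c , K) ∷ us)                ≡⟨ value-ʳ++ ts ((c , K) ∷ us) ⟩
    value ts + (c * p ^ (E ∸ K) + value us)    ≡⟨ +-assoc (value ts) (c * p ^ (E ∸ K)) (value us) ⟨
    value ts + c * p ^ (E ∸ K) + value us      ≡⟨ cong (λ n → n + value us) (+-comm (value ts) (c * p ^ (E ∸ K))) ⟩
    c * p ^ (E ∸ K) + value ts + value us      ∎
    where open ≡-Reasoning

  value-reverse : ∀ ts → value (reverse ts) ≡ value ts
  value-reverse ts = trans (value-ʳ++ ts []) (+-identityʳ (value ts))

module DigitMatching (p : ℕ) .{{_ : NonZero p}} (p≥2 : 2 ≤ p) (g : ℕ) (1≤g : 1 ≤ g) (D T : ℕ) where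

  open Powers p

  Digit : ℕ → Set
  Digit c = c < p ^ g × ¬ p ∣ c

  Digits : List Term → Set
  Digits = ListAll.All (Digit ∘ proj₁)

  carryBound : ℕ
  carryBound = T * p ^ g + 2

  -- Room for the window (K ∸ g, K] of a term, the p-power D in γ's denominator and the carry.
  gap : ℕ
  gap = g + D + carryBound + g

  data Sparse : ℕ → List Term → Set where
    [] : ∀ {u} → Sparse u []
    cons : ∀ {u c K ts} → K ≤ u → gap ≤ K → Sparse (K ∸ gap) ts → Sparse u ((c , K) ∷ ts)

  data Descending : ℕ → List Term → Set where
    [] : ∀ {u} → Descending u []
    cons : ∀ {u c L ts} → L < u → Descending L ts → Descending u ((c , L) ∷ ts)

  CarryFits : ℕ → List Term → ℤ → Set
  CarryFits θ [] e = ⊤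
  CarryFits θ ((_ , K) ∷ _) e = ∣ e ∣ < p ^ (θ ∸ K)

  CarryFits-0 : ∀ θ ts → CarryFits θ ts 0ℤ
  CarryFits-0 θ [] = tt
  CarryFits-0 θ ((_ , K) ∷ _) = m^n>0 p (θ ∸ K)

  Sparse⇒≤ : ∀ {u ts} → Sparse u ts → ListAll.All (λ t → proj₂ t ≤ u) ts
  Sparse⇒≤ [] = []
  Sparse⇒≤ (cons {K = K} K≤u _ s) =
    K≤u ∷ ListAll.map (λ le → ≤-trans le (≤-trans (m∸n≤m K gap) K≤u)) (Sparse⇒≤ s)

  Descending⇒< : ∀ {u ts} → Descending u ts → ListAll.All (λ t → proj₂ t < u) ts
  Descending⇒< [] = []
  Descending⇒< (cons L<u d) = L<u ∷ ListAll.map (λ lt → <-trans lt L<u) (Descending⇒< d)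

  Sparse-weaken : ∀ {u u' ts} → u ≤ u' → Sparse u ts → Sparse u' ts
  Sparse-weaken _ [] = []
  Sparse-weaken u≤u' (cons K≤u gap≤K s) = cons (≤-trans K≤u u≤u') gap≤K s

  Descending-weaken : ∀ {u u' ts} → u ≤ u' → Descending u ts → Descending u' ts
  Descending-weaken _ [] = []
  Descending-weaken u≤u' (cons L<u d) = cons (<-≤-trans L<u u≤u') d

  Sparse-terms : ∀ {A : Set} (f : A → ℕ) {n} off acc (xs : Vec A n) ks →
    Sparse off acc → All (gap ≤_) ks →
    Sparse (off + sum ks) (terms f off xs ks ʳ++ acc)
  Sparse-terms f off acc [] [] sparse [] = Sparse-weaken (m≤m+n off 0) sparse
  Sparse-terms f off acc (x ∷ xs) (k ∷ ks) sparse (gap≤k ∷ gap≤ks) =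
    subst (λ u → Sparse u (terms f off (x ∷ xs) (k ∷ ks) ʳ++ acc)) (+-assoc off k (sum ks))
      (Sparse-terms f (off + k) ((f x , off + k) ∷ acc) xs ks
        (cons ≤-refl (≤-trans gap≤k (m≤n+m k off))
          (Sparse-weaken (m+n≤o⇒m≤o∸n off (+-monoʳ-≤ off gap≤k)) sparse))
        gap≤ks)

  Descending-terms : ∀ {A : Set} (f : A → ℕ) {n} off acc (xs : Vec A n) ks →
    Descending (suc off) acc → All (1 ≤_) ks →
    Descending (suc (off + sum ks)) (terms f off xs ks ʳ++ acc)
  Descending-terms f off acc [] [] descending [] = Descending-weaken (s≤s (m≤m+n off 0)) descending
  Descending-terms f off acc (x ∷ xs) (k ∷ ks) descending (1≤k ∷ 1≤ks) =
    subst (λ u → Descending (suc u) (terms f off (x ∷ xs) (k ∷ ks) ʳ++ acc)) (+-assoc off k (sum ks))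
      (Descending-terms f (off + k) ((f x , off + k) ∷ acc) xs ks
        (cons ≤-refl (Descending-weaken (subst (_≤ off + k) (+-comm off 1) (+-monoʳ-≤ off 1≤k)) descending))
        1≤ks)

  Digit⇒>0 : ∀ {c} → Digit c → 1 ≤ c
  Digit⇒>0 {zero} (_ , p∤0) = ⊥-elim (p∤0 (ℕD._∣0 p))
  Digit⇒>0 {suc c} _ = s≤s z≤n

  split-above : ∀ θ {u} ts → Descending u ts →
    Σ (List Term) λ h → Σ (List Term) λ l →
      ts ≡ h ++ l × ListAll.All (λ t → θ < proj₂ t × proj₂ t < u) h × Descending (suc θ) l
  split-above θ [] _ = [] , [] , refl , [] , []
  split-above θ ((c , L) ∷ ts) (cons L<u d) with θ <? L
  ... | no θ≮L = [] , (c , L) ∷ ts , refl , [] , cons (s≤s (≮⇒≥ θ≮L)) d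
  ... | yes θ<L with split-above θ ts d
  ...   | h , l , refl , inside , dl =
    (c , L) ∷ h , l , refl , (θ<L , L<u) ∷ ListAll.map (λ (θ<L' , L'<L) → θ<L' , <-trans L'<L L<u) inside , dl

  g+D≤gap : g + D ≤ gap
  g+D≤gap = ≤-trans (m≤m+n (g + D) carryBound) (m≤m+n (g + D + carryBound) g)

  1≤gap : 1 ≤ gap
  1≤gap = ≤-trans 1≤g (≤-trans (m≤m+n g D) g+D≤gap)

  carryBound+g≤gap : carryBound + g ≤ gap
  carryBound+g≤gap = +-monoˡ-≤ g (m≤n+m carryBound (g + D))

  carry-fits : ∀ {K e} ts → gap ≤ K → Sparse (K ∸ gap) ts → ∣ e ∣ < carryBound → CarryFits (K ∸ g) ts e
  carry-fits [] _ _ _ = tt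
  carry-fits {K} ((_ , K') ∷ _) gap≤K (cons K'≤K∸gap _ _) ∣e∣<bound =
    <-≤-trans ∣e∣<bound (≤-trans bound≤ (<⇒≤ (n<p^n p≥2 _)))
    where
    open ≤-Reasoning
    bound+K'+g≤K : carryBound + K' + g ≤ K
    bound+K'+g≤K = begin
      carryBound + K' + g          ≡⟨ +-assoc carryBound K' g ⟩
      carryBound + (K' + g)        ≡⟨ cong (λ n → carryBound + n) (+-comm K' g) ⟩
      carryBound + (g + K')        ≡⟨ +-assoc carryBound g K' ⟨
      carryBound + g + K'          ≤⟨ +-mono-≤ carryBound+g≤gap K'≤K∸gap ⟩
      gap + (K ∸ gap)              ≡⟨ m+[n∸m]≡n gap≤K ⟩
      K                            ∎
    bound≤ : carryBound ≤ (K ∸ g) ∸ K'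
    bound≤ = m+n≤o⇒m≤o∸n carryBound (m+n≤o⇒m≤o∸n (carryBound + K') bound+K'+g≤K)

  module Matching (E : ℕ) where

    open Expansion p E public

    value≤ : ∀ {θ} ts → ListAll.All (λ t → θ ≤ proj₂ t) ts → Digits ts →
      value ts ≤ length ts * (p ^ g * p ^ (E ∸ θ))
    value≤ [] [] [] = z≤n
    value≤ ((c , K) ∷ ts) (θ≤K ∷ θ≤) ((c<p^g , _) ∷ digits) =
      +-mono-≤ (*-mono-≤ (<⇒≤ c<p^g) (^-monoʳ-≤ p (∸-monoʳ-≤ E θ≤K))) (value≤ ts θ≤ digits)

    residue : ℕ → ℕ → List Term → ℤ → ℕ → ℤ
    residue A K h e θ = + (A * p ^ (E ∸ K)) ℤ.- + value h ℤ.+ e ℤ.* + p ^ (E ∸ θ)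

    residue-[] : ∀ {A K θ} e → K ≤ θ → θ ≤ E →
      residue A K [] e θ ≡ (+ (A * p ^ (θ ∸ K)) ℤ.+ e) ℤ.* + p ^ (E ∸ θ)
    residue-[] {A} {K} {θ} e K≤θ θ≤E = begin
      + (A * p ^ (E ∸ K)) ℤ.- + 0 ℤ.+ e ℤ.* + r
        ≡⟨ cong (λ n → + (A * n) ℤ.- + 0 ℤ.+ e ℤ.* + r) (p^-split K≤θ θ≤E) ⟩
      + (A * (q * r)) ℤ.- + 0 ℤ.+ e ℤ.* + r
        ≡⟨ cong (λ n → + n ℤ.- + 0 ℤ.+ e ℤ.* + r) (*-assoc A q r) ⟨
      + (A * q * r) ℤ.- + 0 ℤ.+ e ℤ.* + r
        ≡⟨ cong (λ n → n ℤ.- + 0 ℤ.+ e ℤ.* + r) (ℤP.pos-* (A * q) r) ⟩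
      + (A * q) ℤ.* + r ℤ.- + 0 ℤ.+ e ℤ.* + r
        ≡⟨ factor (+ (A * q)) e (+ r) ⟩
      (+ (A * q) ℤ.+ e) ℤ.* + r ∎
      where
      open ≡-Reasoning
      q = p ^ (θ ∸ K)
      r = p ^ (E ∸ θ)
      factor : ∀ a e r → a ℤ.* r ℤ.- + 0 ℤ.+ e ℤ.* r ≡ (a ℤ.+ e) ℤ.* r
      factor = solve-∀

    lone-head-impossible : ∀ {A K θ e} → Digit A → g ≤ K → K ≤ θ → θ ≤ E → ∣ e ∣ < p ^ (θ ∸ K) →
      ¬ (+ p ^ (E ∸ (K ∸ g)) ∣ℤ residue A K [] e θ)
    lone-head-impossible {A} {K} {θ} {e} digit@(A<p^g , _) g≤K K≤θ θ≤E ∣e∣<q p^∣residue =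
      +[m*n]+i≢0 {A} {q} {e} (Digit⇒>0 digit) ∣e∣<q (∣ℤ-small⇒≡0 p^g*q∣x ∣x∣<p^g*q)
      where
      q = p ^ (θ ∸ K)
      x = + (A * q) ℤ.+ e
      p^g*q∣x : + (p ^ g * q) ∣ℤ x
      p^g*q∣x = subst (λ n → + n ∣ℤ x)
        (trans (p^-split (m∸n≤m K g) K≤θ) (cong (λ n → p ^ n * q) (m∸[m∸n]≡n g≤K)))
        (+p^-∣ℤ-cancelʳ (θ ∸ (K ∸ g)) (E ∸ θ)
          (subst₂ _∣ℤ_ (cong +_ (p^-split (≤-trans (m∸n≤m K g) K≤θ) θ≤E))
            (residue-[] {A} e K≤θ θ≤E) p^∣residue))
      ∣x∣<p^g*q : ∣ x ∣ < p ^ g * q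
      ∣x∣<p^g*q = begin-strict
        ∣ x ∣          ≤⟨ ℤP.∣i+j∣≤∣i∣+∣j∣ (+ (A * q)) e ⟩
        A * q + ∣ e ∣  <⟨ +-monoʳ-< (A * q) ∣e∣<q ⟩
        A * q + q      ≡⟨ +-comm (A * q) q ⟩
        suc A * q      ≤⟨ *-monoˡ-≤ q A<p^g ⟩
        p ^ g * q      ∎
        where open ≤-Reasoning

    p^[E∸[K∸g]] : ∀ {K} → g ≤ K → K ≤ E → p ^ (E ∸ (K ∸ g)) ≡ p ^ g * p ^ (E ∸ K)
    p^[E∸[K∸g]] {K} g≤K K≤E =
      trans (p^-split (m∸n≤m K g) K≤E) (cong (λ n → p ^ n * p ^ (E ∸ K)) (m∸[m∸n]≡n g≤K))

    digits-match : ∀ {A K B L} → Digit A → Digit B → g ≤ K → K ≤ E → L ≤ E →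
      + p ^ (E ∸ (K ∸ g)) ∣ℤ + (A * p ^ (E ∸ K)) ℤ.- + (B * p ^ (E ∸ L)) → K ≡ L × A ≡ B
    digits-match {A} {K} {B} {L} (A<p^g , p∤A) (B<p^g , p∤B) g≤K K≤E L≤E p^∣diff with <-cmp L K
    ... | tri< L<K _ _ = ⊥-elim (p∤A (∣ℤ-diff∣ʳ⇒∣ˡ p∣A-Bp^ (ℕD.∣n⇒∣m*n B (p∣p^ (m<n⇒0<n∸m L<K)))))
      where
      p^g∣A-Bp^ : + p ^ g ∣ℤ + A ℤ.- + (B * p ^ (K ∸ L))
      p^g∣A-Bp^ = +p^-∣ℤ-cancelʳ g (E ∸ K) (subst₂ _∣ℤ_
        (cong +_ (p^[E∸[K∸g]] g≤K K≤E))
        (trans (cong (λ n → + (A * p ^ (E ∸ K)) ℤ.- + n) (*p^-split B (<⇒≤ L<K) K≤E))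
               (pos-*-distribʳ-‿- A (B * p ^ (K ∸ L)) (p ^ (E ∸ K))))
        p^∣diff)
      p∣A-Bp^ = ℤD.∣-trans (ℤD.∣ᵤ⇒∣ (p∣p^ 1≤g)) p^g∣A-Bp^
    ... | tri> _ _ K<L = ⊥-elim (p∤B (∣ℤ-diff∣ˡ⇒∣ʳ p∣Ap^-B (ℕD.∣n⇒∣m*n A (p∣p^ (m<n⇒0<n∸m K<L)))))
      where
      K∸g≤L = ≤-trans (m∸n≤m K g) (<⇒≤ K<L)
      p^∣Ap^-B : + p ^ (L ∸ (K ∸ g)) ∣ℤ + (A * p ^ (L ∸ K)) ℤ.- + B
      p^∣Ap^-B = +p^-∣ℤ-cancelʳ (L ∸ (K ∸ g)) (E ∸ L) (subst₂ _∣ℤ_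
        (cong +_ (p^-split K∸g≤L L≤E))
        (trans (cong (λ n → + n ℤ.- + (B * p ^ (E ∸ L))) (*p^-split A (<⇒≤ K<L) L≤E))
               (pos-*-distribʳ-‿- (A * p ^ (L ∸ K)) B (p ^ (E ∸ L))))
        p^∣diff)
      p∣Ap^-B = ℤD.∣-trans (ℤD.∣ᵤ⇒∣ (p∣p^ (m<n⇒0<n∸m (≤-<-trans (m∸n≤m K g) K<L)))) p^∣Ap^-B
    ... | tri≈ _ refl _ = refl , ∣ℤ-small-diff⇒≡ p^g∣A-B A<p^g B<p^g
      where
      p^g∣A-B : + p ^ g ∣ℤ + A ℤ.- + B
      p^g∣A-B = +p^-∣ℤ-cancelʳ g (E ∸ K) (subst₂ _∣ℤ_
        (cong +_ (p^[E∸[K∸g]] g≤K K≤E))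
        (pos-*-distribʳ-‿- A B (p ^ (E ∸ K)))
        p^∣diff)

    carry-bound : ∀ {A K θ e e'} h → Digit A → g ≤ K → K ≤ θ → θ ≤ E → ∣ e ∣ < p ^ (θ ∸ K) →
      ListAll.All (λ t → K ∸ g ≤ proj₂ t) h → Digits h → length h ≤ T →
      residue A K h e θ ≡ e' ℤ.* + p ^ (E ∸ (K ∸ g)) → ∣ e' ∣ < carryBound
    carry-bound {A} {K} {θ} {e} {e'} h (A<p^g , _) g≤K K≤θ θ≤E ∣e∣<p^ h-above h-digits ∣h∣≤T residue≡ =
      *-cancelʳ-< m ∣ e' ∣ carryBound (begin-strict
        ∣ e' ∣ * m                                 ≡⟨ ℤP.abs-* e' (+ m) ⟨
        ∣ e' ℤ.* + m ∣                             ≡⟨ cong ∣_∣ residue≡ ⟨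
        ∣ + (A * p^K) ℤ.- + value h ℤ.+ e ℤ.* + p^θ ∣
          ≤⟨ ℤP.∣i+j∣≤∣i∣+∣j∣ (+ (A * p^K) ℤ.- + value h) (e ℤ.* + p^θ) ⟩
        ∣ + (A * p^K) ℤ.- + value h ∣ + ∣ e ℤ.* + p^θ ∣
          ≤⟨ +-monoˡ-≤ ∣ e ℤ.* + p^θ ∣ (ℤP.∣i-j∣≤∣i∣+∣j∣ (+ (A * p^K)) (+ value h)) ⟩
        A * p^K + value h + ∣ e ℤ.* + p^θ ∣        ≡⟨ cong (λ n → A * p^K + value h + n) (ℤP.abs-* e (+ p^θ)) ⟩
        A * p^K + value h + ∣ e ∣ * p^θ            <⟨ +-mono-<-≤ (+-mono-<-≤ head<m h≤ ) carry≤m ⟩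
        m + T * (p ^ g * m) + m                    ≡⟨ collect T (p ^ g) m ⟩
        carryBound * m                             ∎)
      where
      open ≤-Reasoning
      m = p ^ (E ∸ (K ∸ g))
      p^K = p ^ (E ∸ K)
      p^θ = p ^ (E ∸ θ)
      head<m : A * p^K < m
      head<m = subst (A * p^K <_) (sym (p^[E∸[K∸g]] g≤K (≤-trans K≤θ θ≤E)))
        (*-monoˡ-< p^K {{p^n-nonZero {E ∸ K}}} A<p^g)
      h≤ : value h ≤ T * (p ^ g * m)
      h≤ = ≤-trans (value≤ h h-above h-digits) (*-monoˡ-≤ (p ^ g * m) ∣h∣≤T)
      carry≤m : ∣ e ∣ * p^θ ≤ m
      carry≤m = begin
        ∣ e ∣ * p^θ              ≤⟨ *-monoˡ-≤ p^θ (<⇒≤ ∣e∣<p^) ⟩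
        p ^ (θ ∸ K) * p^θ        ≡⟨ p^-split K≤θ θ≤E ⟨
        p^K                      ≤⟨ ^-monoʳ-≤ p (∸-monoʳ-≤ E (m∸n≤m K g)) ⟩
        m                        ∎
      collect : ∀ t q m → m + t * (q * m) + m ≡ (t * q + 2) * m
      collect = ℕSolver.solve-∀

    carry : ∀ {A K θ e} As h l → gap ≤ K → Sparse (K ∸ gap) As → Descending (suc (K ∸ g)) l →
      + p ^ (E ∸ D) ∣ℤ + value ((A , K) ∷ As) ℤ.- + value (h ++ l) ℤ.+ e ℤ.* + p ^ (E ∸ θ) →
      Σ ℤ λ e' → residue A K h e θ ≡ e' ℤ.* + p ^ (E ∸ (K ∸ g)) ×
                 + p ^ (E ∸ D) ∣ℤ + value As ℤ.- + value l ℤ.+ e' ℤ.* + p ^ (E ∸ (K ∸ g))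
    carry {A} {K} {θ} {e} As h l gap≤K sparse descending p^∣total =
      e' , residue≡ , subst (+ p ^ (E ∸ D) ∣ℤ_) total≡rest+carry p^∣total
      where
      m = p ^ (E ∸ (K ∸ g))
      rest = + value As ℤ.- + value l
      total≡residue+rest :
        + value ((A , K) ∷ As) ℤ.- + value (h ++ l) ℤ.+ e ℤ.* + p ^ (E ∸ θ) ≡ residue A K h e θ ℤ.+ rest
      total≡residue+rest = begin
        + (A * p ^ (E ∸ K) + value As) ℤ.- + value (h ++ l) ℤ.+ e ℤ.* + p ^ (E ∸ θ)
          ≡⟨ cong (λ n → + (A * p ^ (E ∸ K) + value As) ℤ.- + n ℤ.+ e ℤ.* + p ^ (E ∸ θ)) (value-++ h l) ⟩
        + (A * p ^ (E ∸ K) + value As) ℤ.- + (value h + value l) ℤ.+ e ℤ.* + p ^ (E ∸ θ)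
          ≡⟨ cong₂ (λ x y → x ℤ.- y ℤ.+ e ℤ.* + p ^ (E ∸ θ))
                   (ℤP.pos-+ (A * p ^ (E ∸ K)) (value As)) (ℤP.pos-+ (value h) (value l)) ⟩
        + (A * p ^ (E ∸ K)) ℤ.+ + value As ℤ.- (+ value h ℤ.+ + value l) ℤ.+ e ℤ.* + p ^ (E ∸ θ)
          ≡⟨ regroup (+ (A * p ^ (E ∸ K))) (+ value As) (+ value h) (+ value l) e (+ p ^ (E ∸ θ)) ⟩
        residue A K h e θ ℤ.+ rest ∎
        where
        open ≡-Reasoning
        regroup : ∀ a b c d e t → a ℤ.+ b ℤ.- (c ℤ.+ d) ℤ.+ e ℤ.* t ≡ (a ℤ.- c ℤ.+ e ℤ.* t) ℤ.+ (b ℤ.- d)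
        regroup = solve-∀
      D≤K∸g : D ≤ K ∸ g
      D≤K∸g = m+n≤o⇒m≤o∸n D (subst (_≤ K) (+-comm g D) (≤-trans g+D≤gap gap≤K))
      m∣rest : + m ∣ℤ rest
      m∣rest = ℤD.∣m∣n⇒∣m-n {m = + value As} {n = + value l}
        (ℤD.∣ᵤ⇒∣ (p^-∣value As
          (ListAll.map (λ le → ≤-trans le (∸-monoʳ-≤ K (≤-trans (m≤m+n g D) g+D≤gap))) (Sparse⇒≤ sparse))))
        (ℤD.∣ᵤ⇒∣ (p^-∣value l (ListAll.map ℕ.s≤s⁻¹ (Descending⇒< descending))))
      m∣residue : + m ∣ℤ residue A K h e θ
      m∣residue = ℤD.∣m+n∣n⇒∣m
        (subst (+ m ∣ℤ_) total≡residue+rest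
          (ℤD.∣-trans (ℤD.∣ᵤ⇒∣ (p^-mono-∣ (∸-monoʳ-≤ E D≤K∸g))) p^∣total))
        m∣rest
      e' = ℤD._∣_.quotient m∣residue
      residue≡ : residue A K h e θ ≡ e' ℤ.* + m
      residue≡ = ℤD._∣_.equality m∣residue
      total≡rest+carry :
        + value ((A , K) ∷ As) ℤ.- + value (h ++ l) ℤ.+ e ℤ.* + p ^ (E ∸ θ) ≡ rest ℤ.+ e' ℤ.* + m
      total≡rest+carry = trans total≡residue+rest (trans (cong (ℤ._+ rest) residue≡) (ℤP.+-comm (e' ℤ.* + m) rest))

    lone-partner : ∀ {A K B L θ e'} → Digit A → Digit B → g ≤ K → K ≤ E → L ≤ E →
      residue A K ((B , L) ∷ []) 0ℤ θ ≡ e' ℤ.* + p ^ (E ∸ (K ∸ g)) → K ≡ L × A ≡ B × e' ≡ 0ℤ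
    lone-partner {A} {K} {B} {L} {θ} {e'} A-digit B-digit g≤K K≤E L≤E residue≡ = K≡L , A≡B , e'≡0
      where
      m = p ^ (E ∸ (K ∸ g))
      difference≡ : + (A * p ^ (E ∸ K)) ℤ.- + (B * p ^ (E ∸ L)) ≡ e' ℤ.* + m
      difference≡ = begin
        + (A * p ^ (E ∸ K)) ℤ.- + (B * p ^ (E ∸ L))
          ≡⟨ drop-zeros (+ (A * p ^ (E ∸ K))) (+ (B * p ^ (E ∸ L))) (+ p ^ (E ∸ θ)) ⟨
        + (A * p ^ (E ∸ K)) ℤ.- (+ (B * p ^ (E ∸ L)) ℤ.+ + 0) ℤ.+ 0ℤ ℤ.* + p ^ (E ∸ θ)
          ≡⟨ cong (λ z → + (A * p ^ (E ∸ K)) ℤ.- z ℤ.+ 0ℤ ℤ.* + p ^ (E ∸ θ))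
                  (ℤP.pos-+ (B * p ^ (E ∸ L)) 0) ⟨
        residue A K ((B , L) ∷ []) 0ℤ θ
          ≡⟨ residue≡ ⟩
        e' ℤ.* + m ∎
        where
        open ≡-Reasoning
        drop-zeros : ∀ x y t → x ℤ.- (y ℤ.+ + 0) ℤ.+ + 0 ℤ.* t ≡ x ℤ.- y
        drop-zeros = solve-∀
      K≡L×A≡B = digits-match A-digit B-digit g≤K K≤E L≤E (ℤD.divides e' difference≡)
      K≡L = proj₁ K≡L×A≡B
      A≡B = proj₂ K≡L×A≡B
      e'm≡0 : e' ℤ.* + m ≡ 0ℤ
      e'm≡0 = begin
        e' ℤ.* + m
          ≡⟨ difference≡ ⟨
        + (A * p ^ (E ∸ K)) ℤ.- + (B * p ^ (E ∸ L))
          ≡⟨ cong₂ (λ b l → + (A * p ^ (E ∸ K)) ℤ.- + (b * p ^ (E ∸ l))) A≡B K≡L ⟨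
        + (A * p ^ (E ∸ K)) ℤ.- + (A * p ^ (E ∸ K))
          ≡⟨ ℤP.+-inverseʳ (+ (A * p ^ (E ∸ K))) ⟩
        0ℤ ∎
        where open ≡-Reasoning
      e'≡0 : e' ≡ 0ℤ
      e'≡0 with ℤP.i*j≡0⇒i≡0∨j≡0 e' e'm≡0
      ... | inj₁ e'≡0 = e'≡0
      ... | inj₂ m≡0 = ⊥-elim (ℕ.≢-nonZero⁻¹ m {{p^n-nonZero {E ∸ (K ∸ g)}}} (ℤP.+-injective m≡0))

    match-step : ∀ {A K θ e e'} As h l → Digit A → g ≤ K → K ≤ θ → θ ≤ E → ∣ e ∣ < p ^ (θ ∸ K) →
      ListAll.All (λ t → K ∸ g < proj₂ t × proj₂ t < suc θ) h → Digits h →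
      residue A K h e θ ≡ e' ℤ.* + p ^ (E ∸ (K ∸ g)) →
      length As ≤ length l × (length l ≡ length As → e' ≡ 0ℤ → As ≡ l) →
      length ((A , K) ∷ As) ≤ length (h ++ l) ×
        (length (h ++ l) ≡ length ((A , K) ∷ As) → e ≡ 0ℤ → (A , K) ∷ As ≡ h ++ l)
    match-step {K = K} {e = e} {e'} As [] l digit g≤K K≤θ θ≤E fits _ _ residue≡ _ =
      ⊥-elim (lone-head-impossible {K = K} {e = e} digit g≤K K≤θ θ≤E fits (ℤD.divides e' residue≡))
    match-step {A} {K} {θ} {e} {e'} As ((B , L) ∷ []) l A-digit g≤K K≤θ θ≤E _ ((_ , L<1+θ) ∷ []) (B-digit ∷ [])
      residue≡ (∣As∣≤∣l∣ , IH) = s≤s ∣As∣≤∣l∣ , equal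
      where
      equal : suc (length l) ≡ suc (length As) → e ≡ 0ℤ → (A , K) ∷ As ≡ (B , L) ∷ l
      equal ∣Bs∣≡∣As∣ refl with lone-partner {θ = θ} {e'} A-digit B-digit g≤K (≤-trans K≤θ θ≤E)
                                 (≤-trans (ℕ.s≤s⁻¹ L<1+θ) θ≤E) residue≡
      ... | refl , refl , e'≡0 = cong ((A , K) ∷_) (IH (suc-injective ∣Bs∣≡∣As∣) e'≡0)
    match-step As ((B , L) ∷ t ∷ h) l _ _ _ _ _ _ _ _ (∣As∣≤∣l∣ , _) =
      s≤s (≤-trans ∣As∣≤∣l∣ (≤-trans ∣l∣≤∣h++l∣ (n≤1+n _))) ,
      λ ∣Bs∣≡∣As∣ _ →
        ⊥-elim (<⇒≱ (subst (length l <_) (suc-injective ∣Bs∣≡∣As∣) (s≤s ∣l∣≤∣h++l∣)) ∣As∣≤∣l∣)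
      where
      ∣l∣≤∣h++l∣ : length l ≤ length (h ++ l)
      ∣l∣≤∣h++l∣ = subst (length l ≤_) (sym (ListP.length-++ h)) (m≤n+m (length l) (length h))

    -- Terms of exponent above θ have been compared already, leaving the carry e at level θ.
    match : ∀ As Bs θ e → Sparse θ As → Descending (suc θ) Bs → θ ≤ E → Digits As → Digits Bs →
      length Bs ≤ T → CarryFits θ As e →
      + p ^ (E ∸ D) ∣ℤ + value As ℤ.- + value Bs ℤ.+ e ℤ.* + p ^ (E ∸ θ) →
      length As ≤ length Bs × (length Bs ≡ length As → e ≡ 0ℤ → As ≡ Bs)
    match [] [] _ _ _ _ _ _ _ _ _ _ = z≤n , λ _ _ → refl
    match [] (_ ∷ _) _ _ _ _ _ _ _ _ _ _ = z≤n , λ ()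
    match ((A , K) ∷ As) Bs θ e (cons K≤θ gap≤K sparse) descending θ≤E (A-digit ∷ As-digits) Bs-digits
      ∣Bs∣≤T fits p^∣total
      with split-above (K ∸ g) Bs descending
    ... | h , l , refl , h-inside , l-descending
      with carry {A} {K} {θ} {e} As h l gap≤K sparse l-descending p^∣total
    ... | e' , residue≡ , p^∣rest =
      match-step {A} {K} {θ} {e} {e'} As h l A-digit g≤K K≤θ θ≤E fits h-inside h-digits residue≡
        (match As l (K ∸ g) e' (Sparse-weaken (∸-monoʳ-≤ K g≤gap) sparse) l-descending
          (≤-trans (m∸n≤m K g) (≤-trans K≤θ θ≤E)) As-digits l-digits ∣l∣≤T
          (carry-fits As gap≤K sparse ∣e'∣<bound) p^∣rest)
      where
      g≤gap = ≤-trans (m≤m+n g D) g+D≤gap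
      g≤K = ≤-trans g≤gap gap≤K
      h-digits = ++⁻ˡ h Bs-digits
      l-digits = ++⁻ʳ h Bs-digits
      ∣h∣+∣l∣≤T : length h + length l ≤ T
      ∣h∣+∣l∣≤T = subst (_≤ T) (ListP.length-++ h) ∣Bs∣≤T
      ∣l∣≤T = m+n≤o⇒n≤o (length h) ∣h∣+∣l∣≤T
      ∣e'∣<bound : ∣ e' ∣ < carryBound
      ∣e'∣<bound = carry-bound {A} {K} {θ} {e} {e'} h A-digit g≤K K≤θ θ≤E fits
        (ListAll.map (λ (θ'<L , _) → <⇒≤ θ'<L) h-inside) h-digits
        (m+n≤o⇒m≤o (length h) ∣h∣+∣l∣≤T) residue≡

module ClearedSum (p : ℕ) .{{_ : NonZero p}} (W : ℕ) .{{_ : NonZero W}} (E : ℕ) where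

  open Powers p
  open Scaling W
  open Expansion p E

  term-scaled : ∀ {x} K → Admissible x → K ≤ E →
    x ℚ.* invPow p K ℚ.* fromℤ (+ (W * p ^ E)) ≡ fromℤ (+ (scale x * p ^ (E ∸ K)))
  term-scaled {x} K x-admissible K≤E = begin
    x ℚ.* invPow p K ℚ.* fromℤ (+ (W * p ^ E))
      ≡⟨ cong (λ n → x ℚ.* invPow p K ℚ.* fromℤ (+ (W * n))) p^E≡ ⟩
    x ℚ.* invPow p K ℚ.* fromℤ (+ (W * (p ^ K * p ^ (E ∸ K))))
      ≡⟨ cong (λ z → x ℚ.* invPow p K ℚ.* z) fromℤ-split ⟩
    x ℚ.* invPow p K ℚ.* (fromℤ (+ W) ℚ.* fromℤ (+ p ^ K) ℚ.* fromℤ (+ p ^ (E ∸ K)))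
      ≡⟨ regroup (x) (invPow p K) (fromℤ (+ W)) (fromℤ (+ p ^ K)) (fromℤ (+ p ^ (E ∸ K))) ⟩
    (x ℚ.* fromℤ (+ W)) ℚ.* (invPow p K ℚ.* fromℤ (+ p ^ K)) ℚ.* fromℤ (+ p ^ (E ∸ K))
      ≡⟨ cong₂ (λ u v → u ℚ.* v ℚ.* fromℤ (+ p ^ (E ∸ K)))
               (scale-correct x-admissible) (/-*-cancel (+ 1) (p ^ K) {{p^n-nonZero {K}}}) ⟩
    fromℤ (+ scale x) ℚ.* ℚ.1ℚ ℚ.* fromℤ (+ p ^ (E ∸ K))
      ≡⟨ cong (ℚ._* fromℤ (+ p ^ (E ∸ K))) (ℚP.*-identityʳ (fromℤ (+ scale x))) ⟩
    fromℤ (+ scale x) ℚ.* fromℤ (+ p ^ (E ∸ K))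
      ≡⟨ trans (cong fromℤ (ℤP.pos-* (scale x) (p ^ (E ∸ K)))) (fromℤ-* (+ scale x) (+ p ^ (E ∸ K))) ⟨
    fromℤ (+ (scale x * p ^ (E ∸ K))) ∎
    where
    open ≡-Reasoning
    p^E≡ : p ^ E ≡ p ^ K * p ^ (E ∸ K)
    p^E≡ = trans (cong (p ^_) (sym (m+[n∸m]≡n K≤E))) (^-distribˡ-+-* p K (E ∸ K))
    fromℤ-split :
      fromℤ (+ (W * (p ^ K * p ^ (E ∸ K)))) ≡ fromℤ (+ W) ℚ.* fromℤ (+ p ^ K) ℚ.* fromℤ (+ p ^ (E ∸ K))
    fromℤ-split = begin
      fromℤ (+ (W * (p ^ K * p ^ (E ∸ K))))
        ≡⟨ cong (λ n → fromℤ (+ n)) (*-assoc W (p ^ K) (p ^ (E ∸ K))) ⟨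
      fromℤ (+ (W * p ^ K * p ^ (E ∸ K)))
        ≡⟨ trans (cong fromℤ (ℤP.pos-* (W * p ^ K) (p ^ (E ∸ K)))) (fromℤ-* (+ (W * p ^ K)) (+ p ^ (E ∸ K))) ⟩
      fromℤ (+ (W * p ^ K)) ℚ.* fromℤ (+ p ^ (E ∸ K))
        ≡⟨ cong (ℚ._* fromℤ (+ p ^ (E ∸ K))) (trans (cong fromℤ (ℤP.pos-* W (p ^ K))) (fromℤ-* (+ W) (+ p ^ K))) ⟩
      fromℤ (+ W) ℚ.* fromℤ (+ p ^ K) ℚ.* fromℤ (+ p ^ (E ∸ K)) ∎
    regroup : ∀ (x i w q e : ℚ) → x ℚ.* i ℚ.* (w ℚ.* q ℚ.* e) ≡ (x ℚ.* w) ℚ.* (i ℚ.* q) ℚ.* e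
    regroup = solve 5 (λ x i w q e → x :* i :* (w :* q :* e) := (x :* w) :* (i :* q) :* e) refl
      where open +-*-Solver

  pSumFrom-scaled : ∀ {n} off (xs : Vec ℚ n) ks → All Admissible xs → off + sum ks ≤ E →
    pSumFrom p off xs ks ℚ.* fromℤ (+ (W * p ^ E)) ≡ fromℤ (+ value (terms scale off xs ks))
  pSumFrom-scaled off [] [] [] _ = ℚP.*-zeroˡ (fromℤ (+ (W * p ^ E)))
  pSumFrom-scaled off (x ∷ xs) (k ∷ ks) (x-admissible ∷ xs-admissible) off+Σ≤E = begin
    (x ℚ.* invPow p (off + k) ℚ.+ pSumFrom p (off + k) xs ks) ℚ.* M
      ≡⟨ ℚP.*-distribʳ-+ M (x ℚ.* invPow p (off + k)) (pSumFrom p (off + k) xs ks) ⟩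
    x ℚ.* invPow p (off + k) ℚ.* M ℚ.+ pSumFrom p (off + k) xs ks ℚ.* M
      ≡⟨ cong₂ ℚ._+_ (term-scaled (off + k) x-admissible (m+n≤o⇒m≤o (off + k) off+k+Σ≤E))
                      (pSumFrom-scaled (off + k) xs ks xs-admissible off+k+Σ≤E) ⟩
    fromℤ (+ (scale x * p ^ (E ∸ (off + k)))) ℚ.+ fromℤ (+ value (terms scale (off + k) xs ks))
      ≡⟨ trans (cong fromℤ (ℤP.pos-+ (scale x * p ^ (E ∸ (off + k))) (value (terms scale (off + k) xs ks))))
                (fromℤ-+ (+ (scale x * p ^ (E ∸ (off + k)))) (+ value (terms scale (off + k) xs ks))) ⟨
    fromℤ (+ value (terms scale off (x ∷ xs) (k ∷ ks))) ∎
    where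
    open ≡-Reasoning
    M = fromℤ (+ (W * p ^ E))
    off+k+Σ≤E : off + k + sum ks ≤ E
    off+k+Σ≤E = subst (_≤ E) (sym (+-assoc off k (sum ks))) off+Σ≤E

pSum-cong : ∀ p .{{_ : NonZero p}} {s t} (a : Vec ℚ s) (k : Vec ℕ s) (b : Vec ℚ t) (ℓ : Vec ℕ t) →
  s ≡ t → toList a ≡ toList b → toList k ≡ toList ℓ → pSum p a k ≡ pSum p b ℓ
pSum-cong p a k b ℓ refl a≡b k≡ℓ = cong₂ (pSum p) (toList-injective a b a≡b) (toList-injective k ℓ k≡ℓ)
  where
  toList-injective : ∀ {A : Set} {n} (xs ys : Vec A n) → toList xs ≡ toList ys → xs ≡ ys
  toList-injective xs ys eq = trans (sym (VecP.cast-is-id refl xs)) (VecP.toList-injective refl xs ys eq)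

module Main (p : ℕ) .{{_ : NonZero p}} (p≥2 : 2 ≤ p) {s t : ℕ} (t≤s : t ≤ s)
            (a : Vec ℚ s) (a∈ : All (InNp p) a) (b : Vec ℚ t) (b∈ : All (InNp p) b)
            (d : ℕ) .{{_ : NonZero d}} where

  open Powers p
  open CoprimeMultiple (coprimeMultiple p d) renaming (exponent to D)

  V : ℕ
  V = denominatorProduct a * denominatorProduct b

  W : ℕ
  W = cofactor * V

  instance
    V-nonZero : NonZero V
    V-nonZero = m*n≢0 _ _ {{denominatorProduct-nonZero a}} {{denominatorProduct-nonZero b}}

    W-nonZero : NonZero W
    W-nonZero = m*n≢0 cofactor V {{cofactor-nonZero}}

  open Scaling W

  W-coprime : Coprime W p
  W-coprime = coprime-* cofactor-coprime (coprime-* (denominatorProduct-coprime a a∈) (denominatorProduct-coprime b b∈))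

  a-admissible : All Admissible a
  a-admissible = AllV.map
    (λ ((0<x , _) , ↧∣) → 0<x , ℕD.∣-trans ↧∣ (ℕD.∣-trans (ℕD.m∣m*n _) (ℕD.n∣m*n cofactor)))
    (AllV.zip (a∈ , ↧∣denominatorProduct a))

  b-admissible : All Admissible b
  b-admissible = AllV.map
    (λ ((0<x , _) , ↧∣) → 0<x , ℕD.∣-trans ↧∣ (ℕD.∣-trans (ℕD.n∣m*n (denominatorProduct a)) (ℕD.n∣m*n cofactor)))
    (AllV.zip (b∈ , ↧∣denominatorProduct b))

  g : ℕ
  g = suc (sum (map scale a) + sum (map scale b))

  open DigitMatching p p≥2 g (s≤s z≤n) D t public

  scale-digit : ∀ {x} → scale x < g → InNp p x → Admissible x → Digit (scale x)
  scale-digit scale<g x∈ (_ , ↧∣W) = <-trans scale<g (n<p^n p≥2 g) , p∤scale W-coprime x∈ ↧∣W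

  a-digits : All (Digit ∘ scale) a
  a-digits = AllV.map
    (λ (scale≤ , x∈ , x-admissible) → scale-digit (s≤s (≤-trans scale≤ (m≤m+n _ _))) x∈ x-admissible)
    (AllV.zip (≤-sum-map scale a , AllV.zip (a∈ , a-admissible)))

  b-digits : All (Digit ∘ scale) b
  b-digits = AllV.map
    (λ (scale≤ , x∈ , x-admissible) → scale-digit (s≤s (≤-trans scale≤ (m≤n+m _ _))) x∈ x-admissible)
    (AllV.zip (≤-sum-map scale b , AllV.zip (b∈ , b-admissible)))

  backward : ∀ n k ℓ → (n / d ≡ 0ℚ) × (s ≡ t) × (toList a ≡ toList b) × (toList k ≡ toList ℓ) →
    pSum p a k ≡ (n / d) ℚ.+ pSum p b ℓ
  backward n k ℓ (γ≡0 , s≡t , a≡b , k≡ℓ) = begin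
    pSum p a k                   ≡⟨ pSum-cong p a k b ℓ s≡t a≡b k≡ℓ ⟩
    pSum p b ℓ                   ≡⟨ ℚP.+-identityˡ (pSum p b ℓ) ⟨
    0ℚ ℚ.+ pSum p b ℓ            ≡⟨ cong (ℚ._+ pSum p b ℓ) γ≡0 ⟨
    (n / d) ℚ.+ pSum p b ℓ       ∎
    where open ≡-Reasoning

  module _ (k : Vec ℕ s) (ℓ : Vec ℕ t) where

    E : ℕ
    E = D + sum k + sum ℓ

    open Matching E
    open ClearedSum p W E

    -- Reversed, so that the least significant term comes first.
    As : List Term
    As = reverse (terms scale 0 a k)

    Bs : List Term
    Bs = reverse (terms scale 0 b ℓ)

    Σk≤E : sum k ≤ E
    Σk≤E = ≤-trans (m≤n+m (sum k) D) (m≤m+n (D + sum k) (sum ℓ))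

    Σℓ≤E : sum ℓ ≤ E
    Σℓ≤E = m≤n+m (sum ℓ) (D + sum k)

    D≤E : D ≤ E
    D≤E = ≤-trans (m≤m+n D (sum k)) (m≤m+n (D + sum k) (sum ℓ))

    q : ℕ
    q = ℕD.quotient divides-multiple

    -- Since d ∣ cofactor·p^D, the γ-term scales to n·X with p^(E ∸ D) ∣ X.
    X : ℕ
    X = q * V * p ^ (E ∸ D)

    W*p^E≡d*X : W * p ^ E ≡ d * X
    W*p^E≡d*X = begin
      cofactor * V * p ^ E
        ≡⟨ cong (λ n → cofactor * V * n) (p^-split z≤n D≤E) ⟩
      cofactor * V * (p ^ D * p ^ (E ∸ D))
        ≡⟨ regroup cofactor V (p ^ D) (p ^ (E ∸ D)) ⟩
      cofactor * p ^ D * (V * p ^ (E ∸ D))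
        ≡⟨ cong (λ n → n * (V * p ^ (E ∸ D))) (ℕD.m∣n⇒n≡quotient*m divides-multiple) ⟩
      q * d * (V * p ^ (E ∸ D))
        ≡⟨ regroup′ q d V (p ^ (E ∸ D)) ⟩
      d * X ∎
      where
      open ≡-Reasoning
      regroup : ∀ c v x y → c * v * (x * y) ≡ c * x * (v * y)
      regroup = ℕSolver.solve-∀
      regroup′ : ∀ q d v y → q * d * (v * y) ≡ d * (q * v * y)
      regroup′ = ℕSolver.solve-∀

    γ-scaled : ∀ n → (n / d) ℚ.* fromℤ (+ (W * p ^ E)) ≡ fromℤ (n ℤ.* + X)
    γ-scaled n = begin
      (n / d) ℚ.* fromℤ (+ (W * p ^ E))
        ≡⟨ cong (λ m → (n / d) ℚ.* fromℤ (+ m)) W*p^E≡d*X ⟩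
      (n / d) ℚ.* fromℤ (+ (d * X))
        ≡⟨ cong ((n / d) ℚ.*_) (trans (cong fromℤ (ℤP.pos-* d X)) (fromℤ-* (+ d) (+ X))) ⟩
      (n / d) ℚ.* (fromℤ (+ d) ℚ.* fromℤ (+ X))
        ≡⟨ ℚP.*-assoc (n / d) (fromℤ (+ d)) (fromℤ (+ X)) ⟨
      (n / d) ℚ.* fromℤ (+ d) ℚ.* fromℤ (+ X)
        ≡⟨ cong (ℚ._* fromℤ (+ X)) (/-*-cancel n d) ⟩
      fromℤ n ℚ.* fromℤ (+ X)
        ≡⟨ fromℤ-* n (+ X) ⟨
      fromℤ (n ℤ.* + X) ∎
      where open ≡-Reasoning

    pSum-scaled : ∀ {m} (xs : Vec ℚ m) ks → All Admissible xs → sum ks ≤ E →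
      pSum p xs ks ℚ.* fromℤ (+ (W * p ^ E)) ≡ fromℤ (+ value (reverse (terms scale 0 xs ks)))
    pSum-scaled xs ks xs-admissible Σ≤E =
      trans (pSumFrom-scaled 0 xs ks xs-admissible Σ≤E)
            (cong (λ v → fromℤ (+ v)) (sym (value-reverse (terms scale 0 xs ks))))

    integral : ∀ n → pSum p a k ≡ (n / d) ℚ.+ pSum p b ℓ → + value As ≡ n ℤ.* + X ℤ.+ + value Bs
    integral n eq = fromℤ-injective (begin
      fromℤ (+ value As)
        ≡⟨ pSum-scaled a k a-admissible Σk≤E ⟨
      pSum p a k ℚ.* M
        ≡⟨ cong (ℚ._* M) eq ⟩
      ((n / d) ℚ.+ pSum p b ℓ) ℚ.* M
        ≡⟨ ℚP.*-distribʳ-+ M (n / d) (pSum p b ℓ) ⟩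
      (n / d) ℚ.* M ℚ.+ pSum p b ℓ ℚ.* M
        ≡⟨ cong₂ ℚ._+_ (γ-scaled n) (pSum-scaled b ℓ b-admissible Σℓ≤E) ⟩
      fromℤ (n ℤ.* + X) ℚ.+ fromℤ (+ value Bs)
        ≡⟨ fromℤ-+ (n ℤ.* + X) (+ value Bs) ⟨
      fromℤ (n ℤ.* + X ℤ.+ + value Bs) ∎)
      where
      open ≡-Reasoning
      M = fromℤ (+ (W * p ^ E))

    p^∣difference : ∀ n → + value As ≡ n ℤ.* + X ℤ.+ + value Bs →
      + p ^ (E ∸ D) ∣ℤ + value As ℤ.- + value Bs ℤ.+ 0ℤ ℤ.* + p ^ (E ∸ E)
    p^∣difference n As≡ = ℤD.divides (n ℤ.* + (q * V)) (begin
      + value As ℤ.- + value Bs ℤ.+ 0ℤ ℤ.* + p ^ (E ∸ E)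
        ≡⟨ cong (λ z → z ℤ.- + value Bs ℤ.+ 0ℤ ℤ.* + p ^ (E ∸ E)) As≡ ⟩
      n ℤ.* + X ℤ.+ + value Bs ℤ.- + value Bs ℤ.+ 0ℤ ℤ.* + p ^ (E ∸ E)
        ≡⟨ cong (λ z → n ℤ.* z ℤ.+ + value Bs ℤ.- + value Bs ℤ.+ 0ℤ ℤ.* + p ^ (E ∸ E))
                (ℤP.pos-* (q * V) (p ^ (E ∸ D))) ⟩
      n ℤ.* (+ (q * V) ℤ.* + p ^ (E ∸ D)) ℤ.+ + value Bs ℤ.- + value Bs ℤ.+ 0ℤ ℤ.* + p ^ (E ∸ E)
        ≡⟨ cancel n (+ (q * V)) (+ p ^ (E ∸ D)) (+ value Bs) (+ p ^ (E ∸ E)) ⟩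
      n ℤ.* + (q * V) ℤ.* + p ^ (E ∸ D) ∎)
      where
      open ≡-Reasoning
      cancel : ∀ n y z b u → n ℤ.* (y ℤ.* z) ℤ.+ b ℤ.- b ℤ.+ 0ℤ ℤ.* u ≡ n ℤ.* y ℤ.* z
      cancel = solve-∀

    forward : ∀ n → All (gap ≤_) k → All (1 ≤_) ℓ → pSum p a k ≡ (n / d) ℚ.+ pSum p b ℓ →
      (n / d ≡ 0ℚ) × (s ≡ t) × (toList a ≡ toList b) × (toList k ≡ toList ℓ)
    forward n k≥gap ℓ≥1 eq = γ≡0 , s≡t , a≡b , k≡ℓ
      where
      ∣As∣≡s : length As ≡ s
      ∣As∣≡s = trans (ListP.length-reverse (terms scale 0 a k)) (length-terms scale 0 a k)
      ∣Bs∣≡t : length Bs ≡ t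
      ∣Bs∣≡t = trans (ListP.length-reverse (terms scale 0 b ℓ)) (length-terms scale 0 b ℓ)
      matched = match As Bs E 0ℤ
        (Sparse-weaken Σk≤E (Sparse-terms scale 0 [] a k [] k≥gap))
        (Descending-weaken (s≤s Σℓ≤E) (Descending-terms scale 0 [] b ℓ [] ℓ≥1))
        ≤-refl (All-ʳ++ (All-terms scale 0 a k a-digits) []) (All-ʳ++ (All-terms scale 0 b ℓ b-digits) [])
        (≤-reflexive ∣Bs∣≡t) (CarryFits-0 E As) (p^∣difference n (integral n eq))
      s≡t : s ≡ t
      s≡t = ≤-antisym (subst₂ _≤_ ∣As∣≡s ∣Bs∣≡t (proj₁ matched)) t≤s
      As≡Bs : As ≡ Bs
      As≡Bs = proj₂ matched (trans ∣Bs∣≡t (trans (sym s≡t) (sym ∣As∣≡s))) refl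
      a≡b×k≡ℓ = terms-injective scale scale-injective 0 a k b ℓ a-admissible b-admissible
        (ListP.reverse-injective As≡Bs)
      a≡b = proj₁ a≡b×k≡ℓ
      k≡ℓ = proj₂ a≡b×k≡ℓ
      γ≡0 : n / d ≡ 0ℚ
      γ≡0 = GroupP.identityˡ-unique (n / d) (pSum p b ℓ) (trans (sym eq) (pSum-cong p a k b ℓ s≡t a≡b k≡ℓ))

lemma5p4 : (p : ℕ) .{{_ : NonZero p}} → 2 ≤ p →
  (s t : ℕ) → t ≤ s →
  (a : Vec ℚ s) → All (InNp p) a →
  (b : Vec ℚ t) → All (InNp p) b →
  (d : ℕ) .{{_ : NonZero d}} →
  Σ ℕ λ C → 1 ≤ C ×
    ((n : ℤ) → (k : Vec ℕ s) → (ℓ : Vec ℕ t) →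
      All (1 ≤_) k → All (1 ≤_) ℓ → All (C ≤_) k →
      ((pSum p a k ≡ (n / d) ℚ.+ pSum p b ℓ)
        ⇔ ((n / d ≡ 0ℚ) × (s ≡ t) × (toList a ≡ toList b) × (toList k ≡ toList ℓ))))
lemma5p4 p p≥2 s t t≤s a a∈ b b∈ d =
  gap , 1≤gap , λ n k ℓ _ ℓ≥1 k≥gap → mk⇔ (forward k ℓ n k≥gap ℓ≥1) (backward n k ℓ)
  where open Main p p≥2 t≤s a a∈ b b∈ d
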